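{- For any $m,n\in\mathbb N$, the underlying set of the $m$-Fuss-Catalan easterly wind poset of order $n$ is in one-to-one correspondence with the set of $m$-trees of degree $n$, and the map $\mathrm{if}\circ\mathrm{bt}$ is such a one-to-one correspondence.
   Context: A signature is a set with an arity map to $\mathbb N$; view $\mathbb N$ as the signature where $k$ has arity $k$, and let $\mathbb N_{\mathbb N}=\mathbb N\sqcup\mathbb N$ (a disjoint copy of $\mathbb N$, again with $k$ of arity $k$). For a signature $S$, an $S$-term is either the leaf $\ell$ or $s\,t_1\cdots t_{|s|}$ with $s\in S$ and $S$-terms $t_i$ (an ordered rooted tree whose internal nodes with $k$ children are decorated by arity-$k$ elements); $T(S)$ denotes the set of $S$-terms; the degree is the number of internal nodes. Internal nodes are numbered in preorder (root, then subterms left to right); $\mathrm{dc}(t)$ is the decoration word; the parent edge of node $i$ is $(\mathrm{pa}(i),\mathrm{lp}(i),i)$ with $i$ the $\mathrm{lp}(i)$-th child (leaves counted) of $\mathrm{pa}(i)$, and $\mathrm{pa}(1)=1,\mathrm{lp}(1)=0$; $\mathrm{cnc}(t)(i)=\mathrm{pa}(i)+1-2^{\mathrm{lp}(i)-a}$ with $a$ the arity of the decoration of $\mathrm{pa}(i)$; $t_1\preceq t_2$ iff $\mathrm{dc}(t_1)=\mathrm{dc}(t_2)$ and $\mathrm{cnc}(t_1)\le\mathrm{cnc}(t_2)$ componentwise. The corolla $c(s)=s\,\ell\cdots\ell$; $F\bullet u$ replaces the leftmost leaf of $F$ by $u$. For a word $w=w_1\cdots w_n$ on $\mathbb N$: $\mathbf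 f^{\uparrow}(w)=n\,c(w_1)\cdots c(w_n)$ and $\mathbf f^{\downarrow}(w)=(\cdots(c(n)\bullet c(w_1))\cdots)\bullet c(w_n)$, where the root symbol $n$ is from the copy of $\mathbb N$. The $m$-Fuss-Catalan easterly wind poset of order $n$ is the set of $\mathbb N_{\mathbb N}$-terms $F$ with $\mathbf f^{\uparrow}(m^n)\preceq F\preceq\mathbf f^{\downarrow}(m^n)$ ($m^n$ the word with $n$ letters $m$). An $m$-tree is an element of $T(\{m+1\})$ (all internal nodes labelled $m+1$, of arity $m+1$). An $m$-binary tree is an element of $T(T(\{m\}))$ where every element of $T(\{m\})$ (an $(m-1)$-tree) is given arity $2$. For an $(m-1)$-tree $U$ of degree $k\ge1$, its right comb is the $m$-binary tree whose root is decorated by $U$, whose first child is a leaf and whose second child is a right comb of $k-1$ internal nodes each decorated by the leaf $\ell\in T(\{m\})$ (so it has $k$ internal nodes and $k+1$ leaves). The map $\mathrm{bt}$ from $m$-trees to $m$-binary trees: $\mathrm{bt}(\ell)=\ell$; otherwise let $U$ be the $(m-1)$-tree obtained from $t$ by keeping the root and recursively deleting the first subterm of every kept internal node, let $T_1,\dots,T_k$ ($k=\deg U$) be the deleted subterms from left to right, and let $R$ be the right comb of $U$; then $\mathrm{bt}(t)$ is obtained from $R$ by replacing, for each $i\in[k]$, the $i$-th leaf of $R$ by $\mathrm{bt}(T_i)$ (the last leaf stays). The inorder traversal of an $m$-binary tree $U\,R_1R_2$ visits $R_1$, then the root, then $R_2$ recursively. For an $m$-binary tree $R$ with $n$ internal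 nodes, $\mathrm{if}(R)$ is the $\mathbb N_{\mathbb N}$-term $n\,U_1\cdots U_n$ where $U_i$ is the decoration (an element of $T(\{m\})\subseteq T(\mathbb N)$) of the $i$-th internal node of $R$ in inorder. -}

module Defs where

open import Data.Nat as ℕ using (ℕ; zero; suc; _+_; _∸_; _^_)
open import Data.Nat.Properties using (m^n≢0)
open import Data.Integer using (+_)
open import Data.Rational as ℚ using (ℚ; _/_; _-_)
open import Data.Unit using (⊤; tt)
open import Data.Sum using (_⊎_; inj₁; inj₂)
open import Data.Product using (_×_; _,_; proj₁)
open import Data.Maybe using (Maybe; just; nothing; fromMaybe)
open import Data.List using (List; []; _∷_; _++_; length)
open import Data.List.Relation.Binary.Pointwise using (Pointwise)
open import Data.Vec as Vec using (Vec; []; _∷_)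
open import Relation.Binary.PropositionalEquality using (_≡_)

record Signature : Set₁ where
  field
    Sym : Set
    ar  : Sym → ℕ
open Signature public

data Term (S : Signature) : Set where
  leaf : Term S
  node : (s : Sym S) → Vec (Term S) (ar S s) → Term S

module _ {S : Signature} where

  mutual
    degree : Term S → ℕ
    degree leaf        = 0
    degree (node s ts) = suc (degreeVec ts)

    degreeVec : ∀ {k} → Vec (Term S) k → ℕ
    degreeVec []       = 0
    degreeVec (t ∷ ts) = degree t + degreeVec ts

  mutual
    dc : Term S → List (Sym S)
    dc leaf        = []
    dc (node s ts) = s ∷ dcVec ts

    dcVec : ∀ {k} → Vec (Term S) k → List (Sym S)
    dcVec []       = []
    dcVec (t ∷ ts) = dc t ++ dcVec ts

  -- pa + 1 - 2^(lp - a), for lp ≤ a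
  cncValue : (pa lp a : ℕ) → ℚ
  cncValue pa lp a = (+ (pa + 1) / 1) - ((+ 1 / (2 ^ (a ∸ lp))) {{m^n≢0 2 (a ∸ lp)}})

  mutual
    -- cncGo t i p lp a : cnc values of the internal nodes of the subterm t, whose
    -- root (if internal) has preorder number i, and is the lp-th child of node p,
    -- the decoration of p having arity a.
    cncGo : Term S → (i p lp a : ℕ) → List ℚ
    cncGo leaf        i p lp a = []
    cncGo (node s ts) i p lp a = cncValue p lp a ∷ cncVec ts i (suc i) 1 (ar S s)

    -- children ts of node p (arity a), the first child being the pos-th one,
    -- and its root (if internal) receiving preorder number i
    cncVec : ∀ {k} → Vec (Term S) k → (p i pos a : ℕ) → List ℚ
    cncVec []       p i pos a = []
    cncVec (t ∷ ts) p i pos a = cncGo t i p pos a ++ cncVec ts p (i + degree t) (suc pos) a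

  -- cnc(t), listed by preorder number; pa(1) = 1, lp(1) = 0
  cnc : Term S → List ℚ
  cnc leaf        = []
  cnc (node s ts) = cncValue 1 0 (ar S s) ∷ cncVec ts 1 2 1 (ar S s)

  _⪯_ : Term S → Term S → Set
  t₁ ⪯ t₂ = (dc t₁ ≡ dc t₂) × Pointwise ℚ._≤_ (cnc t₁) (cnc t₂)

  c : Sym S → Term S
  c s = node s (Vec.replicate (ar S s) leaf)

  mutual
    graftM : Term S → Term S → Maybe (Term S)
    graftM leaf        u = just u
    graftM (node s ts) u with graftVec ts u
    ... | just ts′ = just (node s ts′)
    ... | nothing  = nothing

    graftVec : ∀ {k} → Vec (Term S) k → Term S → Maybe (Vec (Term S) k)
    graftVec []       u = nothing
    graftVec (t ∷ ts) u with graftM t u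
    ... | just t′ = just (t′ ∷ ts)
    ... | nothing with graftVec ts u
    ...   | just ts′ = just (t ∷ ts′)
    ...   | nothing  = nothing

  -- F • u (F unchanged if it has no leaf; this never happens below)
  _•_ : Term S → Term S → Term S
  F • u = fromMaybe F (graftM F u)

  mutual
    replaceLeaves : Term S → List (Term S) → Term S × List (Term S)
    replaceLeaves leaf []           = leaf , []
    replaceLeaves leaf (u ∷ us)     = u , us
    replaceLeaves (node s ts) us with replaceLeavesVec ts us
    ... | ts′ , us′ = node s ts′ , us′

    replaceLeavesVec : ∀ {k} → Vec (Term S) k → List (Term S) → Vec (Term S) k × List (Term S)
    replaceLeavesVec []       us = [] , us
    replaceLeavesVec (t ∷ ts) us with replaceLeaves t us
    ... | t′ , us′ with replaceLeavesVec ts us′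
    ...   | ts′ , us″ = t′ ∷ ts′ , us″

-- ℕ_ℕ = ℕ ⊔ ℕ; inj₁ = the original ℕ, inj₂ = the disjoint copy
arNN : ℕ ⊎ ℕ → ℕ
arNN (inj₁ k) = k
arNN (inj₂ k) = k

NN : Signature
NN = record { Sym = ℕ ⊎ ℕ ; ar = arNN }

single : ℕ → Signature
single k = record { Sym = ⊤ ; ar = λ _ → k }

MTree : ℕ → Set
MTree m = Term (single (suc m))

BinSig : ℕ → Signature
BinSig m = record { Sym = Term (single m) ; ar = λ _ → 2 }

MBinTree : ℕ → Set
MBinTree m = Term (BinSig m)

f↑ : ∀ {n} → Vec ℕ n → Term NN
f↑ {n} w = node (inj₂ n) (Vec.map (λ k → c (inj₁ k)) w)

f↓ : ∀ {n} → Vec ℕ n → Term NN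
f↓ {n} w = Vec.foldl (λ _ → Term NN) (λ F k → F • c (inj₁ k)) (c (inj₂ n)) w

InEasterlyWind : (m n : ℕ) → Term NN → Set
InEasterlyWind m n F = (f↑ (Vec.replicate n m) ⪯ F) × (F ⪯ f↓ (Vec.replicate n m))

module _ {m : ℕ} where

  mutual
    strip : MTree m → Term (single m)
    strip leaf               = leaf
    strip (node tt (_ ∷ ts)) = node tt (stripVec ts)

    stripVec : ∀ {k} → Vec (MTree m) k → Vec (Term (single m)) k
    stripVec []       = []
    stripVec (t ∷ ts) = strip t ∷ stripVec ts

  combℓ : ℕ → MBinTree m
  combℓ zero    = leaf
  combℓ (suc k) = node leaf (leaf ∷ combℓ k ∷ [])

  rightComb : Term (single m) → MBinTree m
  rightComb U = node U (leaf ∷ combℓ (degree U ∸ 1) ∷ [])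

  mutual
    bt : MTree m → MBinTree m
    bt leaf = leaf
    bt t@(node tt (t₀ ∷ ts)) =
      proj₁ (replaceLeaves (rightComb (strip t)) (bt t₀ ∷ btDelVec ts))

    btDel : MTree m → List (MBinTree m)
    btDel leaf               = []
    btDel (node tt (t₀ ∷ ts)) = bt t₀ ∷ btDelVec ts

    btDelVec : ∀ {k} → Vec (MTree m) k → List (MBinTree m)
    btDelVec []       = []
    btDelVec (t ∷ ts) = btDel t ++ btDelVec ts

  inorder : MBinTree m → List (Term (single m))
  inorder leaf                      = []
  inorder (node U (r₁ ∷ r₂ ∷ []))   = inorder r₁ ++ (U ∷ inorder r₂)

  mutual
    embed : Term (single m) → Term NN
    embed leaf         = leaf
    embed (node tt us) = node (inj₁ m) (embedVec us)

    embedVec : ∀ {k} → Vec (Term (single m)) k → Vec (Term NN) k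
    embedVec []       = []
    embedVec (u ∷ us) = embed u ∷ embedVec us

  if : MBinTree m → Term NN
  if R = node (inj₂ (length (inorder R))) (Vec.map embed (Vec.fromList (inorder R)))

-- if (bt t) records only the inorder word of bt t: its decorations U₁ … Uₙ, each an (m−1)-tree,
-- hung below a root of arity n.
--
-- The word of t can be read off t directly, and a shift-reduce parser inverts it, so
-- t ↦ word t is a bijection from m-trees of degree n onto the words of length n satisfying a
-- Łukasiewicz condition: reading left to right, a letter U opens deg U − 1 slots, ℓ fills one,
-- and no slot is left open at the end.
--
-- In n U₁ ⋯ Uₙ the i-th child of the root has cnc value 2 − 2^(i−n) < 2, while every
-- deeper node has value at least 2.  Lying above f↑(mⁿ), whose root children are the first n
-- nodes after the root, thus says that each internal Uᵢ is preceded by at least i − 1 internal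
-- nodes, a ballot condition equivalent to the Łukasiewicz one.  Every such word lies below
-- f↓(mⁿ), a left comb of m-ary nodes under the root (for m = 0 it coincides with f↑(mⁿ)).

module Submission where

open import Defs
import Algebra.Solver.Monoid as MonoidSolver
open import Data.Empty using (⊥; ⊥-elim)
open import Data.Integer as ℤ using (+_; +≤+; +<+)
import Data.Integer.Properties as ℤ
open import Data.Integer.Tactic.RingSolver using () renaming (solve-∀ to ℤ-solve-∀)
open import Data.List as List using (List; []; _∷_; _++_; length; replicate; take; drop)
open import Data.List.Properties
  using ( ++-assoc; ++-identityʳ; ++-monoid; length-++; length-map; length-replicate; length-take; map-++
        ; map-injective; map-replicate; take++drop≡id; ∷-injective; ∷-injectiveˡ; ∷-injectiveʳ )
open import Data.List.Relation.Binary.Pointwise as Pointwise using (Pointwise; []; _∷_)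
import Data.List.Relation.Binary.Pointwise.Properties as Pointwise
open import Data.List.Relation.Unary.All using (All; []; _∷_)
import Data.List.Relation.Unary.All.Properties as All
open import Data.Maybe using (Maybe; just; nothing; _>>=_; fromMaybe)
open import Data.Maybe.Properties using (just-injective)
open import Data.Nat as ℕ using (ℕ; zero; suc; _+_; _∸_; _^_; _≤_; _<_; z≤n; s≤s; NonZero; _≤?_)
import Data.Nat.Properties as ℕ
open import Data.Nat.ListAction using (sum)
open import Data.Nat.Tactic.RingSolver using (solve-∀)
open import Data.Product using (Σ; ∃; ∃₂; _×_; _,_; proj₁; proj₂)
open import Data.Rational as ℚ using (ℚ; _/_; 0ℚ; 1ℚ)
import Data.Rational.Properties as ℚ
open import Data.Rational.Unnormalised as ℚᵘ using (mkℚᵘ; *≤*; *<*; *≡*; _≃_)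
import Data.Rational.Unnormalised.Properties as ℚᵘ
open import Data.Sum using (inj₁; inj₂)
open import Data.Unit using (⊤; tt)
open import Data.Vec as Vec using (Vec; []; _∷_)
open import Data.Vec.Properties using (toList-injective; toList-map; toList-replicate; toList∘fromList; length-toList)
open import Data.Vec.Relation.Binary.Equality.Cast using (cast-is-id)
open import Function using (_∘_)
open import Relation.Binary.PropositionalEquality
open import Relation.Nullary using (yes; no; contradiction)

-- Inorder words of m-trees

separated : {A : Set} {S : Signature} → (A → List (Term S)) → List A → List (Term S)
separated f []       = []
separated f (x ∷ xs) = f x ++ leaf ∷ separated f xs

separated-++ : {A : Set} {S : Signature} (f : A → List (Term S)) (xs ys : List A) →
               separated f (xs ++ ys) ≡ separated f xs ++ separated f ys
separated-++ f []       ys = refl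
separated-++ f (x ∷ xs) ys = begin
  f x ++ leaf ∷ separated f (xs ++ ys)           ≡⟨ cong (λ w → f x ++ leaf ∷ w) (separated-++ f xs ys) ⟩
  f x ++ leaf ∷ separated f xs ++ separated f ys ≡⟨ ++-assoc (f x) (leaf ∷ separated f xs) _ ⟨
  (f x ++ leaf ∷ separated f xs) ++ separated f ys ∎
  where open ≡-Reasoning

Letter : ℕ → Set
Letter m = Term (single m)

module _ {m : ℕ} where

  open ≡-Reasoning

  mutual
    deleted : MTree m → List (MTree m)
    deleted leaf                = []
    deleted (node tt (t₀ ∷ ts)) = t₀ ∷ deletedᵛ ts

    deletedᵛ : ∀ {k} → Vec (MTree m) k → List (MTree m)
    deletedᵛ []       = []
    deletedᵛ (t ∷ ts) = deleted t ++ deletedᵛ ts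

  mutual
    length-deleted : (t : MTree m) → length (deleted t) ≡ degree (strip t)
    length-deleted leaf                = refl
    length-deleted (node tt (_ ∷ ts)) = cong suc (length-deletedᵛ ts)

    length-deletedᵛ : ∀ {k} (ts : Vec (MTree m) k) → length (deletedᵛ ts) ≡ degreeVec (stripVec ts)
    length-deletedᵛ []       = refl
    length-deletedᵛ (t ∷ ts) =
      trans (length-++ (deleted t)) (cong₂ _+_ (length-deleted t) (length-deletedᵛ ts))

  -- inorder (bt t), computed on t itself (inorder-bt)
  mutual
    word : MTree m → List (Letter m)
    word leaf                  = []
    word t@(node tt (t₀ ∷ ts)) = word t₀ ++ strip t ∷ deletedWordᵛ ts

    deletedWord : MTree m → List (Letter m)
    deletedWord leaf                = []
    deletedWord (node tt (t₀ ∷ ts)) = word t₀ ++ leaf ∷ deletedWordᵛ ts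

    deletedWordᵛ : ∀ {k} → Vec (MTree m) k → List (Letter m)
    deletedWordᵛ []       = []
    deletedWordᵛ (t ∷ ts) = deletedWord t ++ deletedWordᵛ ts

  mutual
    deletedWordᵛ≡separated : ∀ {k} (ts : Vec (MTree m) k) → deletedWordᵛ ts ≡ separated word (deletedᵛ ts)
    deletedWordᵛ≡separated []       = refl
    deletedWordᵛ≡separated (t ∷ ts) =
      trans (cong₂ _++_ (deletedWord≡separated t) (deletedWordᵛ≡separated ts))
            (sym (separated-++ word (deleted t) (deletedᵛ ts)))

    deletedWord≡separated : (t : MTree m) → deletedWord t ≡ separated word (deleted t)
    deletedWord≡separated leaf                = refl
    deletedWord≡separated (node tt (t₀ ∷ ts)) = cong (λ w → word t₀ ++ leaf ∷ w) (deletedWordᵛ≡separated ts)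

  mutual
    length-word : (t : MTree m) → length (word t) ≡ degree t
    length-word leaf                = refl
    length-word (node tt (t₀ ∷ ts)) = length-word-node t₀ ts

    length-deletedWord : (t : MTree m) → length (deletedWord t) ≡ degree t
    length-deletedWord leaf                = refl
    length-deletedWord (node tt (t₀ ∷ ts)) = length-word-node t₀ ts

    length-deletedWordᵛ : ∀ {k} (ts : Vec (MTree m) k) → length (deletedWordᵛ ts) ≡ degreeVec ts
    length-deletedWordᵛ []       = refl
    length-deletedWordᵛ (t ∷ ts) =
      trans (length-++ (deletedWord t)) (cong₂ _+_ (length-deletedWord t) (length-deletedWordᵛ ts))

    length-word-node : ∀ {x} (t₀ : MTree m) (ts : Vec (MTree m) m) →
                       length (word t₀ ++ x ∷ deletedWordᵛ ts) ≡ suc (degree t₀ + degreeVec ts)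
    length-word-node {x} t₀ ts = begin
      length (word t₀ ++ x ∷ deletedWordᵛ ts)
        ≡⟨ length-++ (word t₀) ⟩
      length (word t₀) + suc (length (deletedWordᵛ ts))
        ≡⟨ cong₂ (λ a b → a + suc b) (length-word t₀) (length-deletedWordᵛ ts) ⟩
      degree t₀ + suc (degreeVec ts)
        ≡⟨ ℕ.+-suc (degree t₀) (degreeVec ts) ⟩
      suc (degree t₀ + degreeVec ts) ∎

  mutual
    btDel≡map-bt : (t : MTree m) → btDel t ≡ List.map bt (deleted t)
    btDel≡map-bt leaf                = refl
    btDel≡map-bt (node tt (t₀ ∷ ts)) = cong (bt t₀ ∷_) (btDelVec≡map-bt ts)

    btDelVec≡map-bt : ∀ {k} (ts : Vec (MTree m) k) → btDelVec ts ≡ List.map bt (deletedᵛ ts)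
    btDelVec≡map-bt []       = refl
    btDelVec≡map-bt (t ∷ ts) =
      trans (cong₂ _++_ (btDel≡map-bt t) (btDelVec≡map-bt ts)) (sym (map-++ bt (deleted t) (deletedᵛ ts)))

  length-btDelVec : ∀ {k} (ts : Vec (MTree m) k) → length (btDelVec ts) ≡ degreeVec (stripVec ts)
  length-btDelVec ts = begin
    length (btDelVec ts)                ≡⟨ cong length (btDelVec≡map-bt ts) ⟩
    length (List.map bt (deletedᵛ ts))  ≡⟨ length-map bt (deletedᵛ ts) ⟩
    length (deletedᵛ ts)                ≡⟨ length-deletedᵛ ts ⟩
    degreeVec (stripVec ts)             ∎

  inorder-fill-combℓ : ∀ k (bs : List (MBinTree m)) → k ≡ length bs →
                       inorder (proj₁ (replaceLeaves (combℓ {m} k) bs)) ≡ separated inorder bs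
  inorder-fill-combℓ zero    []       _  = refl
  inorder-fill-combℓ (suc k) (b ∷ bs) eq =
    cong (λ w → inorder b ++ leaf ∷ w) (inorder-fill-combℓ k bs (ℕ.suc-injective eq))

  mutual
    inorder-bt : (t : MTree m) → inorder (bt t) ≡ word t
    inorder-bt leaf                = refl
    inorder-bt (node tt (t₀ ∷ ts)) =
      cong₂ (λ w w′ → w ++ node tt (stripVec ts) ∷ w′) (inorder-bt t₀) (begin
        inorder (proj₁ (replaceLeaves (combℓ (degreeVec (stripVec ts))) (btDelVec ts)))
          ≡⟨ inorder-fill-combℓ _ (btDelVec ts) (sym (length-btDelVec ts)) ⟩
        separated inorder (btDelVec ts)
          ≡⟨ separated-inorder-btDelVec ts ⟩
        deletedWordᵛ ts ∎)

    separated-inorder-btDel : (t : MTree m) → separated inorder (btDel t) ≡ deletedWord t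
    separated-inorder-btDel leaf                = refl
    separated-inorder-btDel (node tt (t₀ ∷ ts)) =
      cong₂ (λ w w′ → w ++ leaf ∷ w′) (inorder-bt t₀) (separated-inorder-btDelVec ts)

    separated-inorder-btDelVec : ∀ {k} (ts : Vec (MTree m) k) →
                                 separated inorder (btDelVec ts) ≡ deletedWordᵛ ts
    separated-inorder-btDelVec []       = refl
    separated-inorder-btDelVec (t ∷ ts) =
      trans (separated-++ inorder (btDel t) (btDelVec ts))
            (cong₂ _++_ (separated-inorder-btDel t) (separated-inorder-btDelVec ts))

-- Parsing words

split : {A : Set} (k : ℕ) (ys : List A) → k ≤ length ys → ∃₂ λ xs zs → ys ≡ xs ++ zs × length xs ≡ k
split k ys k≤ = take k ys , drop k ys , sym (take++drop≡id k ys) , trans (length-take k ys) (ℕ.m≤n⇒m⊓n≡m k≤)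

length-snoc : {A : Set} (xs : List A) (x : A) → length (xs ++ x ∷ []) ≡ suc (length xs)
length-snoc xs x = trans (length-++ xs) (ℕ.+-comm (length xs) 1)

module _ {m : ℕ} where

  open ≡-Reasoning

  -- The [] clause is junk: it is reached only when too few deleted subterms are supplied.
  mutual
    restore : Letter m → List (MTree m) → MTree m × List (MTree m)
    restore leaf         ts       = leaf , ts
    restore (node tt us) []       = node tt (leaf ∷ proj₁ (restoreᵛ us [])) , []
    restore (node tt us) (t ∷ ts) = node tt (t ∷ proj₁ (restoreᵛ us ts)) , proj₂ (restoreᵛ us ts)

    restoreᵛ : ∀ {k} → Vec (Letter m) k → List (MTree m) → Vec (MTree m) k × List (MTree m)
    restoreᵛ []       ts = [] , ts
    restoreᵛ (u ∷ us) ts =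
      let (t , ts′) = restore u ts ; (vs , ts″) = restoreᵛ us ts′ in t ∷ vs , ts″

  mutual
    restore-strip : (t : MTree m) (rest : List (MTree m)) → restore (strip t) (deleted t ++ rest) ≡ (t , rest)
    restore-strip leaf                rest = refl
    restore-strip (node tt (t₀ ∷ ts)) rest rewrite restoreᵛ-strip ts rest = refl

    restoreᵛ-strip : ∀ {k} (ts : Vec (MTree m) k) (rest : List (MTree m)) →
                     restoreᵛ (stripVec ts) (deletedᵛ ts ++ rest) ≡ (ts , rest)
    restoreᵛ-strip []       rest = refl
    restoreᵛ-strip (t ∷ ts) rest
      rewrite ++-assoc (deleted t) (deletedᵛ ts) rest
            | restore-strip t (deletedᵛ ts ++ rest)
            | restoreᵛ-strip ts rest = refl

  mutual
    restore-complete : (u : Letter m) (ts rest : List (MTree m)) → length ts ≡ degree u →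
      Σ (MTree m) λ t → restore u (ts ++ rest) ≡ (t , rest) × strip t ≡ u × deleted t ≡ ts
    restore-complete leaf         []       rest _  = leaf , refl , refl , refl
    restore-complete (node tt us) (t ∷ ts) rest eq with restoreᵛ-complete us ts rest (ℕ.suc-injective eq)
    ... | vs , r , s , d rewrite r = node tt (t ∷ vs) , refl , cong (node tt) s , cong (t ∷_) d

    restoreᵛ-complete : ∀ {k} (us : Vec (Letter m) k) (ts rest : List (MTree m)) → length ts ≡ degreeVec us →
      Σ (Vec (MTree m) k) λ vs → restoreᵛ us (ts ++ rest) ≡ (vs , rest) × stripVec vs ≡ us × deletedᵛ vs ≡ ts
    restoreᵛ-complete []       []  rest _  = [] , refl , refl , refl
    restoreᵛ-complete (u ∷ us) ts rest eq
      with split (degree u) ts (ℕ.m+n≤o⇒m≤o (degree u) (ℕ.≤-reflexive (sym eq)))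
    ... | ts₁ , ts₂ , refl , len₁
      with restore-complete u ts₁ (ts₂ ++ rest) len₁
         | restoreᵛ-complete us ts₂ rest
             (ℕ.+-cancelˡ-≡ (degree u) _ _
               (trans (cong (_+ length ts₂) (sym len₁)) (trans (sym (length-++ ts₁)) eq)))
    ... | t , r , s , d | vs , r′ , s′ , d′ rewrite ++-assoc ts₁ ts₂ rest | r | r′ =
      t ∷ vs , refl , cong₂ _∷_ s s′ , cong₂ _++_ d d′

  assemble : Vec (Letter m) m → MTree m → List (MTree m) → MTree m
  assemble us t₀ ts = node tt (t₀ ∷ proj₁ (restoreᵛ us ts))

  assemble-strip : (t₀ : MTree m) (ts : Vec (MTree m) m) →
                   assemble (stripVec ts) t₀ (deletedᵛ ts) ≡ node tt (t₀ ∷ ts)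
  assemble-strip t₀ ts =
    cong (λ p → node tt (t₀ ∷ proj₁ p))
         (trans (cong (restoreᵛ (stripVec ts)) (sym (++-identityʳ (deletedᵛ ts)))) (restoreᵛ-strip ts []))

  word-assemble : (us : Vec (Letter m) m) (t₀ : MTree m) (ts : List (MTree m)) → length ts ≡ degreeVec us →
                  word (assemble us t₀ ts) ≡ word t₀ ++ node tt us ∷ separated word ts
  word-assemble us t₀ ts eq with restoreᵛ-complete us ts [] eq
  ... | vs , r , s , d = begin
    word (assemble us t₀ ts)
      ≡⟨ cong (λ p → word (node tt (t₀ ∷ proj₁ p))) (trans (cong (restoreᵛ us) (sym (++-identityʳ ts))) r) ⟩
    word t₀ ++ node tt (stripVec vs) ∷ deletedWordᵛ vs
      ≡⟨ cong₂ (λ x w → word t₀ ++ node tt x ∷ w) s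
               (trans (deletedWordᵛ≡separated vs) (cong (separated word) d)) ⟩
    word t₀ ++ node tt us ∷ separated word ts ∎

  -- A shift-reduce parser for words. The current state holds the tree t read last and a stack
  -- of frames; frame us a ts c is a node whose letter node tt us has been read, with first
  -- subterm a and deleted subterms ts complete, waiting for c + 1 more.
  record Frame : Set where
    constructor frame
    field
      children : Vec (Letter m) m
      first    : MTree m
      done     : List (MTree m)
      pending  : ℕ

  State : Set
  State = MTree m × List Frame

  readNode : Vec (Letter m) m → ℕ → State → State
  readNode us zero    (t , S) = assemble us t [] , S
  readNode us (suc k) (t , S) = leaf , frame us t [] k ∷ S

  step : Letter m → State → Maybe State
  step leaf         (t , [])                        = nothing
  step leaf         (t , frame us a ts zero ∷ S)    = just (assemble us a (ts ++ t ∷ []) , S)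
  step leaf         (t , frame us a ts (suc c) ∷ S) = just (leaf , frame us a (ts ++ t ∷ []) c ∷ S)
  step (node tt us) st                              = just (readNode us (degreeVec us) st)

  run : List (Letter m) → State → Maybe State
  run []       st = just st
  run (x ∷ xs) st = step x st >>= run xs

  run-++ : (xs ys : List (Letter m)) (st : State) → run (xs ++ ys) st ≡ (run xs st >>= run ys)
  run-++ []       ys st = refl
  run-++ (x ∷ xs) ys st with step x st
  ... | nothing = refl
  ... | just st′ = run-++ xs ys st′

  Parses : MTree m → Set
  Parses t = ∀ S → run (word t) (leaf , S) ≡ just (t , S)

  run-separated : ∀ us a ts d ds S → Parses d → All Parses ds →
    run (separated word (d ∷ ds)) (leaf , frame us a ts (length ds) ∷ S) ≡ just (assemble us a (ts ++ d ∷ ds) , S)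
  run-separated us a ts d [] S pd []
    rewrite run-++ (word d) (leaf ∷ []) (leaf , frame us a ts 0 ∷ S) | pd (frame us a ts 0 ∷ S) = refl
  run-separated us a ts d (d′ ∷ ds) S pd (pd′ ∷ pds)
    rewrite run-++ (word d) (leaf ∷ separated word (d′ ∷ ds)) (leaf , frame us a ts (suc (length ds)) ∷ S)
          | pd (frame us a ts (suc (length ds)) ∷ S)
          | run-separated us a (ts ++ d ∷ []) d′ ds S pd′ pds
          | ++-assoc ts (d ∷ []) (d′ ∷ ds) = refl

  run-node : ∀ us t₀ ds S → length ds ≡ degreeVec us → All Parses ds →
    run (node tt us ∷ separated word ds) (t₀ , S) ≡ just (assemble us t₀ ds , S)
  run-node us t₀ []       S eq []          rewrite sym eq = refl
  run-node us t₀ (d ∷ ds) S eq (pd ∷ pds) rewrite sym eq = run-separated us t₀ [] d ds S pd pds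

  mutual
    parses : (t : MTree m) → Parses t
    parses leaf                S = refl
    parses (node tt (t₀ ∷ ts)) S = begin
      run (word t₀ ++ node tt (stripVec ts) ∷ deletedWordᵛ ts) (leaf , S)
        ≡⟨ run-++ (word t₀) _ (leaf , S) ⟩
      (run (word t₀) (leaf , S) >>= run (node tt (stripVec ts) ∷ deletedWordᵛ ts))
        ≡⟨ cong (_>>= run (node tt (stripVec ts) ∷ deletedWordᵛ ts)) (parses t₀ S) ⟩
      run (node tt (stripVec ts) ∷ deletedWordᵛ ts) (t₀ , S)
        ≡⟨ cong (λ w → run (node tt (stripVec ts) ∷ w) (t₀ , S)) (deletedWordᵛ≡separated ts) ⟩
      run (node tt (stripVec ts) ∷ separated word (deletedᵛ ts)) (t₀ , S)
        ≡⟨ run-node (stripVec ts) t₀ (deletedᵛ ts) S (length-deletedᵛ ts) (parsesᵛ ts) ⟩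
      just (assemble (stripVec ts) t₀ (deletedᵛ ts) , S)
        ≡⟨ cong (λ t → just (t , S)) (assemble-strip t₀ ts) ⟩
      just (node tt (t₀ ∷ ts) , S) ∎

    parsesᵛ : ∀ {k} (ts : Vec (MTree m) k) → All Parses (deletedᵛ ts)
    parsesᵛ []       = []
    parsesᵛ (t ∷ ts) = All.++⁺ (parses-deleted t) (parsesᵛ ts)

    parses-deleted : (t : MTree m) → All Parses (deleted t)
    parses-deleted leaf                = []
    parses-deleted (node tt (t₀ ∷ ts)) = parses t₀ ∷ parsesᵛ ts

  word-injective : (t₁ t₂ : MTree m) → word t₁ ≡ word t₂ → t₁ ≡ t₂
  word-injective t₁ t₂ eq = cong proj₁ (just-injective (begin
    just (t₁ , [])           ≡⟨ parses t₁ [] ⟨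
    run (word t₁) (leaf , []) ≡⟨ cong (λ w → run w (leaf , [])) eq ⟩
    run (word t₂) (leaf , []) ≡⟨ parses t₂ [] ⟩
    just (t₂ , [])           ∎))

  -- Lukasiewicz c L: reading L with c open slots, a leaf fills one (so needs one) and a letter
  -- node tt us opens degreeVec us new ones; at the end no slot is open.
  Lukasiewicz : ℕ → List (Letter m) → Set
  Lukasiewicz c       []               = c ≡ 0
  Lukasiewicz c       (node tt us ∷ L) = Lukasiewicz (degreeVec us + c) L
  Lukasiewicz zero    (leaf ∷ L)       = ⊥
  Lukasiewicz (suc c) (leaf ∷ L)       = Lukasiewicz c L

  openSlots : List Frame → ℕ
  openSlots []                     = 0
  openSlots (frame _ _ _ c ∷ S) = suc c + openSlots S

  mutual
    run-complete : ∀ L t S → Lukasiewicz (openSlots S) L → ∃ λ t′ → run L (t , S) ≡ just (t′ , [])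
    run-complete []               t []                          refl = t , refl
    run-complete (leaf ∷ L)       t (frame us a ts zero ∷ S)    ok   = run-complete L _ S ok
    run-complete (leaf ∷ L)       t (frame us a ts (suc c) ∷ S) ok   = run-complete L leaf _ ok
    run-complete (node tt us ∷ L) t S                           ok   = run-readNode-complete us (degreeVec us) L t S ok

    run-readNode-complete : ∀ us k L t S → Lukasiewicz (k + openSlots S) L →
                            ∃ λ t′ → run L (readNode us k (t , S)) ≡ just (t′ , [])
    run-readNode-complete us zero    L t S ok = run-complete L _ S ok
    run-readNode-complete us (suc k) L t S ok = run-complete L leaf (frame us t [] k ∷ S) ok

  mutual
    run-complete⇒Lukasiewicz : ∀ L t S t′ → run L (t , S) ≡ just (t′ , []) → Lukasiewicz (openSlots S) L
    run-complete⇒Lukasiewicz []               t []                          t′ _  = refl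
    run-complete⇒Lukasiewicz (leaf ∷ L)       t (frame us a ts zero ∷ S)    t′ eq =
      run-complete⇒Lukasiewicz L _ S t′ eq
    run-complete⇒Lukasiewicz (leaf ∷ L)       t (frame us a ts (suc c) ∷ S) t′ eq =
      run-complete⇒Lukasiewicz L leaf _ t′ eq
    run-complete⇒Lukasiewicz (node tt us ∷ L) t S                           t′ eq =
      readNode-complete⇒Lukasiewicz us (degreeVec us) L t S t′ eq

    readNode-complete⇒Lukasiewicz : ∀ us k L t S t′ → run L (readNode us k (t , S)) ≡ just (t′ , []) →
                                    Lukasiewicz (k + openSlots S) L
    readNode-complete⇒Lukasiewicz us zero    L t S t′ eq = run-complete⇒Lukasiewicz L _ S t′ eq
    readNode-complete⇒Lukasiewicz us (suc k) L t S t′ eq =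
      run-complete⇒Lukasiewicz L leaf (frame us t [] k ∷ S) t′ eq

  Lukasiewicz-word : (t : MTree m) → Lukasiewicz 0 (word t)
  Lukasiewicz-word t = run-complete⇒Lukasiewicz (word t) leaf [] t (parses t [])

  unparseFrame : Frame → List (Letter m)
  unparseFrame (frame us a ts _) = word a ++ node tt us ∷ separated word ts

  unparseStack : List Frame → List (Letter m)
  unparseStack []      = []
  unparseStack (F ∷ S) = unparseStack S ++ unparseFrame F

  unparse : State → List (Letter m)
  unparse (t , S) = unparseStack S ++ word t

  WellFormed : Frame → Set
  WellFormed (frame us _ ts c) = degreeVec us ≡ suc (length ts + c)

  open MonoidSolver (++-monoid (Letter m)) using (solve; _⊕_; _⊜_; id)

  readNode-unparse : ∀ us k t S → degreeVec us ≡ k →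
    unparse (readNode us k (t , S)) ≡ unparse (t , S) ++ node tt us ∷ [] ×
    (All WellFormed S → All WellFormed (proj₂ (readNode us k (t , S))))
  readNode-unparse us zero t S eq =
    trans (cong (unparseStack S ++_) (word-assemble us t [] (sym eq)))
          (sym (++-assoc (unparseStack S) (word t) (node tt us ∷ []))) ,
    λ wf → wf
  readNode-unparse us (suc k) t S eq =
    solve 3 (λ P C U → (P ⊕ (C ⊕ U)) ⊕ id ⊜ (P ⊕ C) ⊕ U) refl (unparseStack S) (word t) (node tt us ∷ []) ,
    eq ∷_

  step-unparse : ∀ x t S st → All WellFormed S → step x (t , S) ≡ just st →
                 unparse st ≡ unparse (t , S) ++ x ∷ [] × All WellFormed (proj₂ st)
  step-unparse leaf t (frame us a ts zero ∷ S) _ (wf ∷ wfs) refl =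
    (begin
      unparseStack S ++ word (assemble us a (ts ++ t ∷ []))
        ≡⟨ cong (unparseStack S ++_) (word-assemble us a (ts ++ t ∷ []) length-ts∷ʳt) ⟩
      unparseStack S ++ (word a ++ node tt us ∷ separated word (ts ++ t ∷ []))
        ≡⟨ cong (λ w → unparseStack S ++ (word a ++ node tt us ∷ w)) (separated-++ word ts (t ∷ [])) ⟩
      unparseStack S ++ (word a ++ node tt us ∷ (separated word ts ++ (word t ++ leaf ∷ [])))
        ≡⟨ solve 6 (λ P A U Q C ℓ → P ⊕ (A ⊕ (U ⊕ (Q ⊕ (C ⊕ ℓ)))) ⊜ ((P ⊕ (A ⊕ (U ⊕ Q))) ⊕ C) ⊕ ℓ)
             refl
             (unparseStack S) (word a) (node tt us ∷ []) (separated word ts) (word t) (leaf ∷ []) ⟩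
      ((unparseStack S ++ (word a ++ node tt us ∷ separated word ts)) ++ word t) ++ leaf ∷ [] ∎) ,
    wfs
    where
    length-ts∷ʳt : length (ts ++ t ∷ []) ≡ degreeVec us
    length-ts∷ʳt = trans (length-snoc ts t) (sym (trans wf (cong suc (ℕ.+-identityʳ (length ts)))))
  step-unparse leaf t (frame us a ts (suc c) ∷ S) _ (wf ∷ wfs) refl =
    (begin
      (unparseStack S ++ (word a ++ node tt us ∷ separated word (ts ++ t ∷ []))) ++ []
        ≡⟨ cong (λ w → (unparseStack S ++ (word a ++ node tt us ∷ w)) ++ []) (separated-++ word ts (t ∷ [])) ⟩
      (unparseStack S ++ (word a ++ node tt us ∷ (separated word ts ++ (word t ++ leaf ∷ [])))) ++ []
        ≡⟨ solve 6 (λ P A U Q C ℓ → (P ⊕ (A ⊕ (U ⊕ (Q ⊕ (C ⊕ ℓ))))) ⊕ id ⊜ ((P ⊕ (A ⊕ (U ⊕ Q))) ⊕ C) ⊕ ℓ)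
             refl
             (unparseStack S) (word a) (node tt us ∷ []) (separated word ts) (word t) (leaf ∷ []) ⟩
      ((unparseStack S ++ (word a ++ node tt us ∷ separated word ts)) ++ word t) ++ leaf ∷ [] ∎) ,
    trans wf (cong suc (trans (ℕ.+-suc (length ts) c) (cong (_+ c) (sym (length-snoc ts t))))) ∷ wfs
  step-unparse (node tt us) t S _ wfs refl =
    let (unparse-eq , wf) = readNode-unparse us (degreeVec us) t S refl in unparse-eq , wf wfs

  run-unparse : ∀ L st st′ → All WellFormed (proj₂ st) → run L st ≡ just st′ →
                unparse st′ ≡ unparse st ++ L
  run-unparse []      st st′ _  refl = sym (++-identityʳ (unparse st))
  run-unparse (x ∷ L) st st′ wf eq with step x st in step-eq
  ... | just st″ with step-unparse x (proj₁ st) (proj₂ st) st″ wf step-eq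
  ...   | unparse-eq , wf″ = begin
    unparse st′                   ≡⟨ run-unparse L st″ st′ wf″ eq ⟩
    unparse st″ ++ L              ≡⟨ cong (_++ L) unparse-eq ⟩
    (unparse st ++ x ∷ []) ++ L   ≡⟨ ++-assoc (unparse st) (x ∷ []) L ⟩
    unparse st ++ x ∷ L           ∎

  word-surjective : (L : List (Letter m)) → Lukasiewicz 0 L → ∃ λ t → word t ≡ L
  word-surjective L ok with run-complete L leaf [] ok
  ... | t , eq = t , run-unparse L (leaf , []) (t , []) [] eq

-- Unit fractions and cnc values

toℚᵘ-/suc : ∀ n d → ℚ.toℚᵘ (+ n / suc d) ≃ mkℚᵘ (+ n) d
toℚᵘ-/suc n d = ℚ.toℚᵘ-fromℚᵘ (mkℚᵘ (+ n) d)

1/-antimono-≤ : ∀ {a b} .{{_ : NonZero a}} .{{_ : NonZero b}} → a ≤ b → + 1 / b ℚ.≤ + 1 / a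
1/-antimono-≤ {suc a} {suc b} (s≤s a≤b) =
  ℚ.toℚᵘ-cancel-≤ (ℚᵘ.≤-respʳ-≃ (ℚᵘ.≃-sym (toℚᵘ-/suc 1 a))
                   (ℚᵘ.≤-respˡ-≃ (ℚᵘ.≃-sym (toℚᵘ-/suc 1 b)) (*≤* (+≤+ (s≤s (ℕ.+-monoˡ-≤ 0 a≤b))))))

1/-antimono-< : ∀ {a b} .{{_ : NonZero a}} .{{_ : NonZero b}} → a < b → + 1 / b ℚ.< + 1 / a
1/-antimono-< {suc a} {suc b} (s≤s a<b) =
  ℚ.toℚᵘ-cancel-< (ℚᵘ.<-respʳ-≃ (ℚᵘ.≃-sym (toℚᵘ-/suc 1 a))
                   (ℚᵘ.<-respˡ-≃ (ℚᵘ.≃-sym (toℚᵘ-/suc 1 b)) (*<* (+<+ (s≤s (ℕ.+-monoˡ-< 0 a<b))))))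

/1-mono-≤ : ∀ {k k′} → k ≤ k′ → + k / 1 ℚ.≤ + k′ / 1
/1-mono-≤ {k} {k′} k≤k′ =
  ℚ.toℚᵘ-cancel-≤ (ℚᵘ.≤-respʳ-≃ (ℚᵘ.≃-sym (toℚᵘ-/suc k′ 0)) (ℚᵘ.≤-respˡ-≃ (ℚᵘ.≃-sym (toℚᵘ-/suc k 0))
    (*≤* (subst₂ ℤ._≤_ (sym (ℤ.*-identityʳ (+ k))) (sym (ℤ.*-identityʳ (+ k′))) (+≤+ k≤k′)))))

+1/1-1≡/1 : ∀ k → + (k + 1) / 1 ℚ.- 1ℚ ≡ + k / 1
+1/1-1≡/1 k = ℚ.toℚᵘ-injective (begin
  ℚ.toℚᵘ (+ (k + 1) / 1 ℚ.- 1ℚ)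
    ≈⟨ ℚ.toℚᵘ-homo-+ (+ (k + 1) / 1) (ℚ.- 1ℚ) ⟩
  ℚ.toℚᵘ (+ (k + 1) / 1) ℚᵘ.+ ℚ.toℚᵘ (ℚ.- 1ℚ)
    ≈⟨ ℚᵘ.+-cong (toℚᵘ-/suc (k + 1) 0) (ℚᵘ.≃-trans (ℚ.toℚᵘ-homo‿- 1ℚ) (ℚᵘ.-‿cong (toℚᵘ-/suc 1 0))) ⟩
  mkℚᵘ (+ (k + 1)) 0 ℚᵘ.- mkℚᵘ (+ 1) 0
    ≈⟨ *≡* (subst (λ z → (z ℤ.* + 1 ℤ.+ ℤ.- + 1 ℤ.* + 1) ℤ.* + 1 ≡ + k ℤ.* + 1) (sym (ℤ.pos-+ k 1)) (ring (+ k))) ⟩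
  mkℚᵘ (+ k) 0
    ≈⟨ toℚᵘ-/suc k 0 ⟨
  ℚ.toℚᵘ (+ k / 1) ∎)
  where
  open ℚᵘ.≃-Reasoning
  ring : ∀ x → ((x ℤ.+ ℤ.1ℤ) ℤ.* + 1 ℤ.+ ℤ.- + 1 ℤ.* + 1) ℤ.* + 1 ≡ x ℤ.* + 1
  ring = ℤ-solve-∀

halfPow : ℕ → ℚ
halfPow e = (+ 1 / 2 ^ e) {{ℕ.m^n≢0 2 e}}

halfPow-antimono-≤ : ∀ {e e′} → e ≤ e′ → halfPow e′ ℚ.≤ halfPow e
halfPow-antimono-≤ {e} {e′} e≤e′ =
  1/-antimono-≤ {{ℕ.m^n≢0 2 e}} {{ℕ.m^n≢0 2 e′}} (ℕ.^-monoʳ-≤ 2 e≤e′)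

halfPow-antimono-< : ∀ {e e′} → e < e′ → halfPow e′ ℚ.< halfPow e
halfPow-antimono-< {e} {e′} e<e′ =
  1/-antimono-< {{ℕ.m^n≢0 2 e}} {{ℕ.m^n≢0 2 e′}} (ℕ.^-monoʳ-< 2 (s≤s (s≤s z≤n)) e<e′)

0≤halfPow : ∀ e → 0ℚ ℚ.≤ halfPow e
0≤halfPow e = ℚ.nonNegative⁻¹ (halfPow e) {{ℚ.normalize-nonNeg 1 (2 ^ e) {{ℕ.m^n≢0 2 e}}}}

halfPow≤1 : ∀ e → halfPow e ℚ.≤ 1ℚ
halfPow≤1 e = halfPow-antimono-≤ {0} {e} ℕ.z≤n

cncValue-antimono-≤ : ∀ p a {i j} → i ≤ j → cncValue {NN} p j a ℚ.≤ cncValue {NN} p i a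
cncValue-antimono-≤ p a {i} {j} i≤j =
  ℚ.+-monoʳ-≤ (+ (p + 1) / 1) (ℚ.neg-antimono-≤ (halfPow-antimono-≤ {a ∸ j} {a ∸ i} (ℕ.∸-monoʳ-≤ a i≤j)))

cncValue-cancel-≤ : ∀ p a {i j} → j ≤ a → cncValue {NN} p i a ℚ.≤ cncValue {NN} p j a → j ≤ i
cncValue-cancel-≤ p a {i} {j} j≤a vᵢ≤vⱼ with j ≤? i
... | yes j≤i = j≤i
... | no  j≰i = contradiction (ℚ.<-≤-trans vⱼ<vᵢ vᵢ≤vⱼ) (ℚ.<-irrefl refl)
  where
  vⱼ<vᵢ : cncValue {NN} p j a ℚ.< cncValue {NN} p i a
  vⱼ<vᵢ = ℚ.+-monoʳ-< (+ (p + 1) / 1)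
            (ℚ.neg-antimono-< (halfPow-antimono-< {a ∸ j} {a ∸ i} (ℕ.∸-monoʳ-< (ℕ.≰⇒> j≰i) j≤a)))

cncValue≤ : ∀ p i a → cncValue {NN} p i a ℚ.≤ + (p + 1) / 1
cncValue≤ p i a = subst (cncValue {NN} p i a ℚ.≤_) (ℚ.+-identityʳ (+ (p + 1) / 1))
  (ℚ.+-monoʳ-≤ (+ (p + 1) / 1) (ℚ.neg-antimono-≤ (0≤halfPow (a ∸ i))))

≤cncValue : ∀ p i a → + p / 1 ℚ.≤ cncValue {NN} p i a
≤cncValue p i a = subst (ℚ._≤ cncValue {NN} p i a) (+1/1-1≡/1 p)
  (ℚ.+-monoʳ-≤ (+ (p + 1) / 1) (ℚ.neg-antimono-≤ (halfPow≤1 (a ∸ i))))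

cncValue-mono-parent : ∀ {p q} i a j b → p < q → cncValue {NN} p i a ℚ.≤ cncValue {NN} q j b
cncValue-mono-parent {p} {q} i a j b p<q =
  ℚ.≤-trans (cncValue≤ p i a) (ℚ.≤-trans (/1-mono-≤ (subst (_≤ q) (ℕ.+-comm 1 p) p<q)) (≤cncValue q j b))

-- The lower bound f↑ and the ballot condition

infix 4 _≼_

_≼_ : List ℚ → List ℚ → Set
_≼_ = Pointwise ℚ._≤_

≼-++⁻ʳ : ∀ {ws xs ys zs} → length ws ≡ length xs → (ws ++ ys) ≼ (xs ++ zs) → ys ≼ zs
≼-++⁻ʳ {[]}     {[]}     _  le      = le
≼-++⁻ʳ {_ ∷ ws} {_ ∷ xs} eq (_ ∷ le) = ≼-++⁻ʳ {ws} {xs} (ℕ.suc-injective eq) le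

applyFrom : {A : Set} → (ℕ → A) → ℕ → ℕ → List A
applyFrom f q zero    = []
applyFrom f q (suc k) = f q ∷ applyFrom f (suc q) k

applyFrom-+ : {A : Set} (f : ℕ → A) (q a b : ℕ) → applyFrom f q (a + b) ≡ applyFrom f q a ++ applyFrom f (q + a) b
applyFrom-+ f q zero    b = cong (λ z → applyFrom f z b) (sym (ℕ.+-identityʳ q))
applyFrom-+ f q (suc a) b =
  cong (f q ∷_) (trans (applyFrom-+ f (suc q) a b)
                       (cong (λ z → applyFrom f (suc q) a ++ applyFrom f z b) (sym (ℕ.+-suc q a))))

length-applyFrom : {A : Set} (f : ℕ → A) (q k : ℕ) → length (applyFrom f q k) ≡ k
length-applyFrom f q zero    = refl
length-applyFrom f q (suc k) = cong suc (length-applyFrom f (suc q) k)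

replicate-+ : {A : Set} (a b : ℕ) (x : A) → replicate (a + b) x ≡ replicate a x ++ replicate b x
replicate-+ zero    b x = refl
replicate-+ (suc a) b x = cong (x ∷_) (replicate-+ a b x)

+-suc-interchange : ∀ p c k → p + c + suc k ≡ suc p + (k + c)
+-suc-interchange = solve-∀

module _ {S : Signature} where

  mutual
    length-cncGo : ∀ (t : Term S) i p lp a → length (cncGo t i p lp a) ≡ degree t
    length-cncGo leaf        i p lp a = refl
    length-cncGo (node s ts) i p lp a = cong suc (length-cncVec ts i (suc i) 1 (ar S s))

    length-cncVec : ∀ {k} (ts : Vec (Term S) k) p i pos a → length (cncVec ts p i pos a) ≡ degreeVec ts
    length-cncVec []       p i pos a = refl
    length-cncVec (t ∷ ts) p i pos a =
      trans (length-++ (cncGo t i p pos a))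
            (cong₂ _+_ (length-cncGo t i p pos a) (length-cncVec ts p (i + degree t) (suc pos) a))

  leaves : ∀ k → Vec (Term S) k
  leaves k = Vec.replicate k leaf

  cncVec-leaves : ∀ k p i pos a → cncVec (leaves k) p i pos a ≡ []
  cncVec-leaves zero    p i pos a = refl
  cncVec-leaves (suc k) p i pos a = cncVec-leaves k p (i + 0) (suc pos) a

  dcVec-leaves : ∀ k → dcVec (leaves k) ≡ []
  dcVec-leaves zero    = refl
  dcVec-leaves (suc k) = dcVec-leaves k

rootChildValue : ℕ → ℕ → ℚ
rootChildValue n q = cncValue {NN} 1 q n

mutual
  rootChildValue≼cncGo : ∀ (t : Term NN) n {q p lp a} → 2 ≤ p → p ≤ q →
                         applyFrom (rootChildValue n) q (degree t) ≼ cncGo t (suc q) p lp a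
  rootChildValue≼cncGo leaf        n             _   _   = []
  rootChildValue≼cncGo (node s ts) n {q} {lp = lp} {a} 2≤p p≤q =
    cncValue-mono-parent q n lp a 2≤p ∷
      rootChildValue≼cncVec ts n (ℕ.≤-trans 2≤p (ℕ.m≤n⇒m≤1+n p≤q)) ℕ.≤-refl

  rootChildValue≼cncVec : ∀ {k} (ts : Vec (Term NN) k) n {q p pos a} → 2 ≤ p → p ≤ q →
                          applyFrom (rootChildValue n) q (degreeVec ts) ≼ cncVec ts p (suc q) pos a
  rootChildValue≼cncVec []       n             _   _   = []
  rootChildValue≼cncVec (t ∷ ts) n {q} 2≤p p≤q
    rewrite applyFrom-+ (rootChildValue n) q (degree t) (degreeVec ts) =
    Pointwise.++⁺ (rootChildValue≼cncGo t n 2≤p p≤q)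
                  (rootChildValue≼cncVec ts n 2≤p (ℕ.≤-trans p≤q (ℕ.m≤m+n q (degree t))))

module _ {m : ℕ} where

  embeds : (L : List (Letter m)) → Vec (Term NN) (length L)
  embeds L = Vec.map embed (Vec.fromList L)

  ifWord : List (Letter m) → Term NN
  ifWord L = node (inj₂ (length L)) (embeds L)

  totalDegree : List (Letter m) → ℕ
  totalDegree L = sum (List.map degree L)

  mutual
    degree-embed : (u : Letter m) → degree (embed u) ≡ degree u
    degree-embed leaf         = refl
    degree-embed (node tt us) = cong suc (degreeVec-embedVec us)

    degreeVec-embedVec : ∀ {k} (us : Vec (Letter m) k) → degreeVec (embedVec us) ≡ degreeVec us
    degreeVec-embedVec []       = refl
    degreeVec-embedVec (u ∷ us) = cong₂ _+_ (degree-embed u) (degreeVec-embedVec us)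

  mutual
    dc-embed : (u : Letter m) → dc (embed u) ≡ replicate (degree u) (inj₁ m)
    dc-embed leaf         = refl
    dc-embed (node tt us) = cong (inj₁ m ∷_) (dcVec-embedVec us)

    dcVec-embedVec : ∀ {k} (us : Vec (Letter m) k) → dcVec (embedVec us) ≡ replicate (degreeVec us) (inj₁ m)
    dcVec-embedVec []       = refl
    dcVec-embedVec (u ∷ us) =
      trans (cong₂ _++_ (dc-embed u) (dcVec-embedVec us)) (sym (replicate-+ (degree u) (degreeVec us) (inj₁ m)))

  dcVec-embeds : (L : List (Letter m)) → dcVec (embeds L) ≡ replicate (totalDegree L) (inj₁ m)
  dcVec-embeds []      = refl
  dcVec-embeds (u ∷ L) =
    trans (cong₂ _++_ (dc-embed u) (dcVec-embeds L)) (sym (replicate-+ (degree u) (totalDegree L) (inj₁ m)))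

  rootChildValue≼cncVec-embedVec : ∀ {k} (us : Vec (Letter m) k) n {q p pos a} → 2 ≤ p → p ≤ q →
                                   applyFrom (rootChildValue n) q (degreeVec us) ≼ cncVec (embedVec us) p (suc q) pos a
  rootChildValue≼cncVec-embedVec us n {q} {p} {pos} {a} 2≤p p≤q =
    subst (λ k → applyFrom (rootChildValue n) q k ≼ cncVec (embedVec us) p (suc q) pos a) (degreeVec-embedVec us)
          (rootChildValue≼cncVec (embedVec us) n 2≤p p≤q)

  -- Ballot p d L: reading L as the root children from position p on, after d internal nodes,
  -- every internal child at position p' is preceded by at least p' − 1 internal nodes.
  Ballot : ℕ → ℕ → List (Letter m) → Set
  Ballot p d []               = ⊤
  Ballot p d (leaf ∷ L)       = Ballot (suc p) d L
  Ballot p d (node tt us ∷ L) = p ≤ suc d × Ballot (suc p) (d + suc (degreeVec us)) L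

  Ballot⇒rootChildValue≼ : ∀ L n p d → Ballot p d L →
    applyFrom (rootChildValue n) (suc d) (totalDegree L) ≼ cncVec (embeds L) 1 (suc (suc d)) p n
  Ballot⇒rootChildValue≼ []               n p d _ = []
  Ballot⇒rootChildValue≼ (leaf ∷ L)       n p d b rewrite ℕ.+-identityʳ d = Ballot⇒rootChildValue≼ L n (suc p) d b
  Ballot⇒rootChildValue≼ (node tt us ∷ L) n p d (p≤ , b)
    rewrite applyFrom-+ (rootChildValue n) (suc (suc d)) (degreeVec us) (totalDegree L) =
    cncValue-antimono-≤ 1 n p≤ ∷
      Pointwise.++⁺ (rootChildValue≼cncVec-embedVec us n (s≤s (s≤s z≤n)) ℕ.≤-refl)
          (subst₂ (λ q i → applyFrom (rootChildValue n) q (totalDegree L) ≼ cncVec (embeds L) 1 i (suc p) n)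
                  (cong suc (ℕ.+-suc d (degreeVec us)))
                  (cong (λ k → suc (suc (d + suc k))) (sym (degreeVec-embedVec us)))
                  (Ballot⇒rootChildValue≼ L n (suc p) (d + suc (degreeVec us)) b))

  rootChildValue≼⇒Ballot : ∀ L n p d → p + length L ≤ suc n →
    applyFrom (rootChildValue n) (suc d) (totalDegree L) ≼ cncVec (embeds L) 1 (suc (suc d)) p n → Ballot p d L
  rootChildValue≼⇒Ballot []               n p d _     _             = tt
  rootChildValue≼⇒Ballot (leaf ∷ L)       n p d room  le rewrite ℕ.+-identityʳ d =
    rootChildValue≼⇒Ballot L n (suc p) d (subst (_≤ suc n) (ℕ.+-suc p (length L)) room) le
  rootChildValue≼⇒Ballot (node tt us ∷ L) n p d room (head ∷ rest)
    rewrite applyFrom-+ (rootChildValue n) (suc (suc d)) (degreeVec us) (totalDegree L) =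
    cncValue-cancel-≤ 1 n p≤n head ,
    rootChildValue≼⇒Ballot L n (suc p) (d + suc (degreeVec us)) (subst (_≤ suc n) (ℕ.+-suc p (length L)) room)
      (subst₂ (λ q i → applyFrom (rootChildValue n) q (totalDegree L) ≼ cncVec (embeds L) 1 i (suc p) n)
              (sym (cong suc (ℕ.+-suc d (degreeVec us))))
              (cong (λ k → suc (suc (d + suc k))) (degreeVec-embedVec us))
              (≼-++⁻ʳ (trans (length-applyFrom (rootChildValue n) (suc (suc d)) (degreeVec us))
                             (sym (trans (length-cncVec (embedVec us) _ _ 1 m) (degreeVec-embedVec us))))
                      rest))
    where
    p≤n : p ≤ n
    p≤n = ℕ.≤-pred (ℕ.≤-trans (s≤s (ℕ.m≤m+n p (length L))) (subst (_≤ suc n) (ℕ.+-suc p (length L)) room))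

  Lukasiewicz-total : ∀ c L → Lukasiewicz c L → totalDegree L + c ≡ length L
  Lukasiewicz-total c       []               ok = ok
  Lukasiewicz-total (suc c) (leaf ∷ L)       ok = trans (ℕ.+-suc (totalDegree L) c) (cong suc (Lukasiewicz-total c L ok))
  Lukasiewicz-total c       (node tt us ∷ L) ok =
    cong suc (trans (exchange (degreeVec us) (totalDegree L) c) (Lukasiewicz-total (degreeVec us + c) L ok))
    where
    exchange : ∀ a b c → a + b + c ≡ b + (a + c)
    exchange = solve-∀

  Lukasiewicz⇒Ballot : ∀ L p d c → suc d ≡ p + c → Lukasiewicz c L → Ballot p d L
  Lukasiewicz⇒Ballot []               p d c       _  _  = tt
  Lukasiewicz⇒Ballot (leaf ∷ L)       p d (suc c) eq ok = Lukasiewicz⇒Ballot L (suc p) d c (trans eq (ℕ.+-suc p c)) ok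
  Lukasiewicz⇒Ballot (node tt us ∷ L) p d c       eq ok =
    subst (p ≤_) (sym eq) (ℕ.m≤m+n p c) ,
    Lukasiewicz⇒Ballot L (suc p) (d + suc (degreeVec us)) (degreeVec us + c)
      (trans (cong (_+ suc (degreeVec us)) eq) (+-suc-interchange p c (degreeVec us))) ok

  Ballot-stuck : ∀ L p d → Ballot p d L → suc d < p → suc (d + totalDegree L) < p + length L
  Ballot-stuck []               p d _ lt rewrite ℕ.+-identityʳ d | ℕ.+-identityʳ p = lt
  Ballot-stuck (leaf ∷ L)       p d b lt =
    subst (suc (d + totalDegree L) <_) (sym (ℕ.+-suc p (length L))) (Ballot-stuck L (suc p) d b (ℕ.m≤n⇒m≤1+n lt))
  Ballot-stuck (node tt us ∷ L) p d (p≤ , _) lt = ⊥-elim (ℕ.<⇒≱ lt p≤)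

  Ballot⇒Lukasiewicz : ∀ L p d c → suc d ≡ p + c → Ballot p d L → p + length L ≡ suc (d + totalDegree L) →
                       Lukasiewicz c L
  Ballot⇒Lukasiewicz []               p d c       eq _ total =
    ℕ.+-cancelˡ-≡ p c 0 (trans (sym eq) (trans (cong suc (sym (ℕ.+-identityʳ d))) (sym total)))
  Ballot⇒Lukasiewicz (leaf ∷ L)       p d zero    eq b total =
    contradiction (trans (sym (ℕ.+-suc p (length L))) total)
                  (ℕ.<⇒≢ (Ballot-stuck L (suc p) d b (s≤s (ℕ.≤-reflexive (trans eq (ℕ.+-identityʳ p)))))
                   ∘ sym)
  Ballot⇒Lukasiewicz (leaf ∷ L)       p d (suc c) eq b total =
    Ballot⇒Lukasiewicz L (suc p) d c (trans eq (ℕ.+-suc p c)) b (trans (sym (ℕ.+-suc p (length L))) total)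
  Ballot⇒Lukasiewicz (node tt us ∷ L) p d c       eq (_ , b) total =
    Ballot⇒Lukasiewicz L (suc p) (d + suc (degreeVec us)) (degreeVec us + c)
      (trans (cong (_+ suc (degreeVec us)) eq) (+-suc-interchange p c (degreeVec us)))
      b (trans (sym (ℕ.+-suc p (length L))) (trans total (cong suc (regroup d (degreeVec us) (totalDegree L)))))
    where
    regroup : ∀ d k t → d + suc (k + t) ≡ d + suc k + t
    regroup = solve-∀

  corollas : ∀ r → Vec (Term NN) r
  corollas r = Vec.map (λ k → c (inj₁ k)) (Vec.replicate r m)

  cncVec-corollas : ∀ r i pos n → cncVec (corollas r) 1 i pos n ≡ applyFrom (rootChildValue n) pos r
  cncVec-corollas zero    i pos n = refl
  cncVec-corollas (suc r) i pos n rewrite cncVec-leaves {NN} m i (suc i) 1 m =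
    cong (rootChildValue n pos ∷_) (cncVec-corollas r _ (suc pos) n)

  dcVec-corollas : ∀ r → dcVec (corollas r) ≡ replicate r (inj₁ m)
  dcVec-corollas zero    = refl
  dcVec-corollas (suc r) rewrite dcVec-leaves {NN} m = cong (inj₁ m ∷_) (dcVec-corollas r)

  Lukasiewicz⇒f↑⪯ : ∀ L → Lukasiewicz 0 L → f↑ (Vec.replicate (length L) m) ⪯ ifWord L
  Lukasiewicz⇒f↑⪯ L ok =
    cong (inj₂ n ∷_)
      (trans (dcVec-corollas n) (trans (cong (λ k → replicate k (inj₁ m)) (sym total)) (sym (dcVec-embeds L)))) ,
    ℚ.≤-refl ∷
      subst (_≼ cncVec (embeds L) 1 2 1 n)
            (trans (cong (applyFrom (rootChildValue n) 1) total) (sym (cncVec-corollas n 2 1 n)))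
            (Ballot⇒rootChildValue≼ L n 1 0 (Lukasiewicz⇒Ballot L 1 0 0 refl ok))
    where
    n = length L
    total : totalDegree L ≡ n
    total = trans (sym (ℕ.+-identityʳ (totalDegree L))) (Lukasiewicz-total 0 L ok)

  f↑⪯⇒Lukasiewicz : ∀ L → f↑ (Vec.replicate (length L) m) ⪯ ifWord L → Lukasiewicz 0 L
  f↑⪯⇒Lukasiewicz L (dc-eq , _ ∷ le) =
    Ballot⇒Lukasiewicz L 1 0 0 refl
      (rootChildValue≼⇒Ballot L n 1 0 ℕ.≤-refl
        (subst (_≼ cncVec (embeds L) 1 2 1 n)
               (trans (cncVec-corollas n 2 1 n) (cong (applyFrom (rootChildValue n) 1) total)) le))
      (cong suc total)
    where
    n = length L
    total : n ≡ totalDegree L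
    total = begin
      n                                            ≡⟨ length-replicate n ⟨
      length (replicate n (inj₁ m))                ≡⟨ cong length (sym (dcVec-corollas n)) ⟩
      length (dcVec (corollas n))                  ≡⟨ cong length (∷-injectiveʳ dc-eq) ⟩
      length (dcVec (embeds L))                    ≡⟨ cong length (dcVec-embeds L) ⟩
      length (replicate (totalDegree L) (inj₁ m))  ≡⟨ length-replicate (totalDegree L) ⟩
      totalDegree L                                ∎
      where open ≡-Reasoning

-- The upper bound f↓

⪯-refl : ∀ {S} {t : Term S} → t ⪯ t
⪯-refl = refl , Pointwise.refl ℚ.≤-refl

firstChildValue : ℕ → ℕ → ℚ
firstChildValue m q = cncValue {NN} q 1 m

module _ {m : ℕ} where

  cncValue≤firstChildValue : ∀ {p q lp} → p ≤ q → cncValue {NN} p (suc lp) m ℚ.≤ firstChildValue m q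
  cncValue≤firstChildValue {p} {q} {lp} p≤q with ℕ.m≤n⇒m<n∨m≡n p≤q
  ... | inj₁ p<q  = cncValue-mono-parent (suc lp) m 1 m p<q
  ... | inj₂ refl = cncValue-antimono-≤ p m (s≤s z≤n)

  mutual
    cncGo-embed≼ : ∀ (u : Letter m) {q p lp} → p ≤ q →
                   cncGo (embed u) (suc q) p (suc lp) m ≼ applyFrom (firstChildValue m) q (degree u)
    cncGo-embed≼ leaf         _   = []
    cncGo-embed≼ (node tt us) p≤q = cncValue≤firstChildValue p≤q ∷ cncVec-embedVec≼ us ℕ.≤-refl

    cncVec-embedVec≼ : ∀ {k} (us : Vec (Letter m) k) {q p pos} → p ≤ q →
                       cncVec (embedVec us) p (suc q) (suc pos) m ≼ applyFrom (firstChildValue m) q (degreeVec us)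
    cncVec-embedVec≼ []       _ = []
    cncVec-embedVec≼ (u ∷ us) {q} p≤q
      rewrite applyFrom-+ (firstChildValue m) q (degree u) (degreeVec us) | degree-embed u =
      Pointwise.++⁺ (cncGo-embed≼ u p≤q) (cncVec-embedVec≼ us (ℕ.≤-trans p≤q (ℕ.m≤m+n q (degree u))))

  cncVec-embeds≼ : ∀ (L : List (Letter m)) n {q p} → 2 ≤ q →
                   cncVec (embeds L) 1 (suc q) p n ≼ applyFrom (firstChildValue m) q (totalDegree L)
  cncVec-embeds≼ []               n     _   = []
  cncVec-embeds≼ (leaf ∷ L)       n {q} 2≤q rewrite ℕ.+-identityʳ q = cncVec-embeds≼ L n 2≤q
  cncVec-embeds≼ (node tt us ∷ L) n {q} {p} 2≤q
    rewrite applyFrom-+ (firstChildValue m) (suc q) (degreeVec us) (totalDegree L)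
          | degreeVec-embedVec us | ℕ.+-suc q (degreeVec us) =
    cncValue-mono-parent p n 1 m 2≤q ∷
      Pointwise.++⁺ (cncVec-embedVec≼ us ℕ.≤-refl)
          (cncVec-embeds≼ L n (ℕ.≤-trans 2≤q (ℕ.≤-trans (ℕ.m≤m+n q (degreeVec us)) (ℕ.n≤1+n _))))

module _ {S : Signature} where

  graftVec-here : ∀ {k} (x : Term S) (w : Vec (Term S) k) u x′ → graftM x u ≡ just x′ →
                  graftVec (x ∷ w) u ≡ just (x′ ∷ w)
  graftVec-here x w u x′ eq with graftM x u | eq
  ... | just .x′ | refl = refl

  graftVec-there : ∀ {k} (x : Term S) (w : Vec (Term S) k) u w′ → graftM x u ≡ nothing →
                   graftVec w u ≡ just w′ → graftVec (x ∷ w) u ≡ just (x ∷ w′)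
  graftVec-there x w u w′ eq eq′ with graftM x u | eq
  ... | nothing | refl with graftVec w u | eq′
  ...   | just .w′ | refl = refl

  graftM-node : ∀ s (w : Vec (Term S) (ar S s)) u w′ → graftVec w u ≡ just w′ →
                graftM (node s w) u ≡ just (node s w′)
  graftM-node s w u w′ eq with graftVec w u | eq
  ... | just .w′ | refl = refl

graftAll : ∀ {r} → Vec ℕ r → Term NN → Term NN
graftAll w F = Vec.foldl (λ _ → Term NN) (λ F k → F • c (inj₁ k)) F w

-- For arity m + 1, f↓ is the root with a left comb of m+1-ary nodes (the spine) as first child.
module _ (m : ℕ) where

  spine : ℕ → Term NN
  spine zero    = leaf
  spine (suc j) = node (inj₁ (suc m)) (spine j ∷ leaves m)

  graftM-spine : ∀ j → graftM (spine j) (c (inj₁ (suc m))) ≡ just (spine (suc j))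
  graftM-spine zero    = refl
  graftM-spine (suc j) =
    graftM-node (inj₁ (suc m)) (spine j ∷ leaves m) (c (inj₁ (suc m))) (spine (suc j) ∷ leaves m)
      (graftVec-here (spine j) (leaves m) (c (inj₁ (suc m))) (spine (suc j)) (graftM-spine j))

  spineTerm : ℕ → ℕ → Term NN
  spineTerm n j = node (inj₂ (suc n)) (spine j ∷ leaves n)

  graftM-spineTerm : ∀ n j → graftM (spineTerm n j) (c (inj₁ (suc m))) ≡ just (spineTerm n (suc j))
  graftM-spineTerm n j =
    graftM-node (inj₂ (suc n)) (spine j ∷ leaves n) (c (inj₁ (suc m))) (spine (suc j) ∷ leaves n)
      (graftVec-here (spine j) (leaves n) (c (inj₁ (suc m))) (spine (suc j)) (graftM-spine j))

  graftAll-spineTerm : ∀ r n j → graftAll (Vec.replicate r (suc m)) (spineTerm n j) ≡ spineTerm n (r + j)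
  graftAll-spineTerm zero    n j = refl
  graftAll-spineTerm (suc r) n j =
    trans (cong (λ F → graftAll (Vec.replicate r (suc m)) (fromMaybe (spineTerm n j) F)) (graftM-spineTerm n j))
          (trans (graftAll-spineTerm r n (suc j)) (cong (spineTerm n) (ℕ.+-suc r j)))

  f↓≡spineTerm : ∀ n → f↓ (Vec.replicate (suc n) (suc m)) ≡ spineTerm n (suc n)
  f↓≡spineTerm n = trans (graftAll-spineTerm (suc n) n 0) (cong (spineTerm n) (ℕ.+-identityʳ (suc n)))

  dc-spine : ∀ j → dc (spine j) ≡ replicate j (inj₁ (suc m))
  dc-spine zero    = refl
  dc-spine (suc j) rewrite dcVec-leaves {NN} m | ++-identityʳ (dc (spine j)) = cong (inj₁ (suc m) ∷_) (dc-spine j)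

  cncGo-spine : ∀ j q → cncGo (spine j) (suc q) q 1 (suc m) ≡ applyFrom (firstChildValue (suc m)) q j
  cncGo-spine zero    q = refl
  cncGo-spine (suc j) q
    rewrite cncVec-leaves {NN} m (suc q) (suc (suc q) + degree (spine j)) 2 (suc m)
          | ++-identityʳ (cncGo (spine j) (suc (suc q)) (suc q) 1 (suc m)) =
    cong (firstChildValue (suc m) q ∷_) (cncGo-spine j (suc q))

  cncVec-spineTerm : ∀ n → cncVec (spine (suc n) ∷ leaves n) 1 2 1 (suc n) ≡
                           cncValue {NN} 1 1 (suc n) ∷ applyFrom (firstChildValue (suc m)) 2 n
  cncVec-spineTerm n
    rewrite cncVec-leaves {NN} n 1 (2 + degree (spine (suc n))) 2 (suc n)
          | ++-identityʳ (cncGo (spine (suc n)) 2 1 1 (suc n))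
          | cncVec-leaves {NN} m 2 (3 + degree (spine n)) 2 (suc m)
          | ++-identityʳ (cncGo (spine n) 3 2 1 (suc m))
          | cncGo-spine n 2 = refl

  ifWord⪯spineTerm : ∀ (us : Vec (Letter (suc m)) (suc m)) (L : List (Letter (suc m))) →
                     Lukasiewicz 0 (node tt us ∷ L) → ifWord (node tt us ∷ L) ⪯ spineTerm (length L) (suc (length L))
  ifWord⪯spineTerm us L ok =
    cong (inj₂ N ∷_) (begin
      dcVec (embeds (node tt us ∷ L))                   ≡⟨ dcVec-embeds (node tt us ∷ L) ⟩
      replicate (suc (degreeVec us + totalDegree L)) _  ≡⟨ cong (λ k → replicate (suc k) (inj₁ (suc m))) total ⟩
      replicate N (inj₁ (suc m))                        ≡⟨ dc-spine N ⟨
      dc (spine N)                                      ≡⟨ ++-identityʳ (dc (spine N)) ⟨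
      dc (spine N) ++ []                                ≡⟨ cong (dc (spine N) ++_) (dcVec-leaves {NN} (length L)) ⟨
      dc (spine N) ++ dcVec (leaves (length L))         ∎) ,
    ℚ.≤-refl ∷ subst (cncVec (embeds (node tt us ∷ L)) 1 2 1 N ≼_) (sym (cncVec-spineTerm (length L)))
                     (ℚ.≤-refl ∷ subst (λ k → tail ≼ applyFrom (firstChildValue (suc m)) 2 k) total tail≼)
    where
    open ≡-Reasoning
    N = suc (length L)
    total : degreeVec us + totalDegree L ≡ length L
    total = ℕ.suc-injective (trans (sym (ℕ.+-identityʳ _)) (Lukasiewicz-total 0 (node tt us ∷ L) ok))
    tail : List ℚ
    tail = cncVec (embedVec us) 2 3 1 (suc m) ++ cncVec (embeds L) 1 (3 + degreeVec (embedVec us)) 2 N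
    tail≼ : tail ≼ applyFrom (firstChildValue (suc m)) 2 (degreeVec us + totalDegree L)
    tail≼ rewrite applyFrom-+ (firstChildValue (suc m)) 2 (degreeVec us) (totalDegree L) | degreeVec-embedVec us =
      Pointwise.++⁺ (cncVec-embedVec≼ us ℕ.≤-refl) (cncVec-embeds≼ L N (s≤s (s≤s z≤n)))

-- For arity 0, f↓ = f↑: each grafted corolla is leafless, so grafting fills the root's leaves in turn.
u₀ : Term NN
u₀ = c (inj₁ 0)

graftVec-u₀ : ∀ a r {k} (w : Vec (Term NN) k) → Vec.toList w ≡ replicate a u₀ ++ leaf ∷ replicate r leaf →
              ∃ λ w′ → graftVec w u₀ ≡ just w′ × Vec.toList w′ ≡ replicate (suc a) u₀ ++ replicate r leaf
graftVec-u₀ zero    r (x ∷ w) eq with ∷-injective eq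
... | refl , eq′ = u₀ ∷ w , refl , cong (u₀ ∷_) eq′
graftVec-u₀ (suc a) r (x ∷ w) eq with ∷-injective eq
... | refl , eq′ with graftVec-u₀ a r w eq′
...   | w′ , g , eq″ = u₀ ∷ w′ , graftVec-there u₀ w u₀ w′ refl g , cong (u₀ ∷_) eq″

graftAll-u₀ : ∀ r a {k} (w : Vec (Term NN) k) → Vec.toList w ≡ replicate a u₀ ++ replicate r leaf →
              ∃ λ w′ → graftAll (Vec.replicate r 0) (node (inj₂ k) w) ≡ node (inj₂ k) w′ ×
                       Vec.toList w′ ≡ replicate (a + r) u₀
graftAll-u₀ zero    a w eq =
  w , refl , trans eq (trans (++-identityʳ _) (cong (λ k → replicate k u₀) (sym (ℕ.+-identityʳ a))))
graftAll-u₀ (suc r) a {k} w eq with graftVec-u₀ a r w eq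
... | w′ , g , eq′ with graftAll-u₀ r (suc a) w′ eq′
...   | w″ , f , eq″ =
  w″ ,
  trans (cong (λ F → graftAll (Vec.replicate r 0) (fromMaybe (node (inj₂ k) w) F))
              (graftM-node (inj₂ k) w u₀ w′ g)) f ,
  trans eq″ (cong (λ k → replicate k u₀) (sym (ℕ.+-suc a r)))

f↓≡f↑-zero : ∀ n → f↓ (Vec.replicate n 0) ≡ f↑ (Vec.replicate n 0)
f↓≡f↑-zero n with graftAll-u₀ n 0 (Vec.replicate n leaf) (toList-replicate n leaf)
... | w , eq , toList-w =
  trans eq (cong (node (inj₂ n)) (trans (sym (cast-is-id refl w)) (toList-injective refl w (corollas {0} n) (begin
    Vec.toList w                                        ≡⟨ toList-w ⟩
    replicate n u₀                                      ≡⟨ map-replicate corolla n 0 ⟨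
    List.map corolla (replicate n 0)                    ≡⟨ cong (List.map corolla) (toList-replicate n 0) ⟨
    List.map corolla (Vec.toList (Vec.replicate n 0))   ≡⟨ toList-map corolla (Vec.replicate n 0) ⟨
    Vec.toList (corollas {0} n)                         ∎))))
  where
  open ≡-Reasoning
  corolla : ℕ → Term NN
  corolla k = c (inj₁ k)

embeds≡corollas : (L : List (Letter 0)) → Lukasiewicz 0 L → embeds L ≡ corollas {0} (length L)
embeds≡corollas []               _  = refl
embeds≡corollas (node tt [] ∷ L) ok = cong (u₀ ∷_) (embeds≡corollas L ok)

Lukasiewicz⇒⪯f↓ : ∀ {m} (L : List (Letter m)) → Lukasiewicz 0 L → ifWord L ⪯ f↓ (Vec.replicate (length L) m)
Lukasiewicz⇒⪯f↓ {zero}  L                ok =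
  subst₂ _⪯_ (cong (node (inj₂ (length L))) (sym (embeds≡corollas L ok))) (sym (f↓≡f↑-zero (length L)))
             (⪯-refl {t = f↑ (Vec.replicate (length L) 0)})
Lukasiewicz⇒⪯f↓ {suc m} []               _  = ⪯-refl {t = ifWord {suc m} []}
Lukasiewicz⇒⪯f↓ {suc m} (node tt us ∷ L) ok =
  subst (ifWord (node tt us ∷ L) ⪯_) (sym (f↓≡spineTerm m (length L))) (ifWord⪯spineTerm m us L ok)

-- The bijection

children : Term NN → List (Term NN)
children leaf        = []
children (node _ ts) = Vec.toList ts

pushRootChild : Term NN → Term NN → Term NN
pushRootChild x (node (inj₂ k) ts) = node (inj₂ (suc k)) (x ∷ ts)
pushRootChild x t                  = t

module _ {m : ℕ} where

  mutual
    embed-injective : (u u′ : Letter m) → embed u ≡ embed u′ → u ≡ u′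
    embed-injective leaf         leaf          _  = refl
    embed-injective (node tt us) (node tt us′) eq = cong (node tt) (embedVec-injective us us′ (cong children eq))

    embedVec-injective : ∀ {k} (us us′ : Vec (Letter m) k) →
                         Vec.toList (embedVec us) ≡ Vec.toList (embedVec us′) → us ≡ us′
    embedVec-injective []       []         _  = refl
    embedVec-injective (u ∷ us) (u′ ∷ us′) eq =
      cong₂ _∷_ (embed-injective u u′ (∷-injectiveˡ eq)) (embedVec-injective us us′ (∷-injectiveʳ eq))

  children-ifWord : (L : List (Letter m)) → children (ifWord {m} L) ≡ List.map embed L
  children-ifWord L = trans (toList-map embed (Vec.fromList L)) (cong (List.map embed) (toList∘fromList L))

  ifWord-injective : (L L′ : List (Letter m)) → ifWord {m} L ≡ ifWord L′ → L ≡ L′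
  ifWord-injective L L′ eq =
    map-injective (λ {u} {u′} → embed-injective u u′)
      (trans (sym (children-ifWord L)) (trans (cong children eq) (children-ifWord L′)))

  mutual
    unembed : (t : Term NN) → All (_≡ inj₁ m) (dc t) → Σ (Letter m) λ u → embed u ≡ t
    unembed leaf        _          = leaf , refl
    unembed (node s ts) (refl ∷ p) with unembedVec ts p
    ... | us , eq = node tt us , cong (node (inj₁ m)) eq

    unembedVec : ∀ {k} (ts : Vec (Term NN) k) → All (_≡ inj₁ m) (dcVec ts) →
                 Σ (Vec (Letter m) k) λ us → embedVec us ≡ ts
    unembedVec []       _ = [] , refl
    unembedVec (t ∷ ts) p with unembed t (All.++⁻ˡ (dc t) p) | unembedVec ts (All.++⁻ʳ (dc t) p)
    ... | u , eq | us , eq′ = u ∷ us , cong₂ _∷_ eq eq′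

  ifWord-toList : ∀ {k} (us : Vec (Letter m) k) → ifWord {m} (Vec.toList us) ≡ node (inj₂ k) (embedVec us)
  ifWord-toList []       = refl
  ifWord-toList (u ∷ us) = cong (pushRootChild (embed u)) (ifWord-toList us)

  InEasterlyWind⇒ifWord : ∀ {n} F → InEasterlyWind m n F →
                          ∃ λ (L : List (Letter m)) → length L ≡ n × ifWord {m} L ≡ F
  InEasterlyWind⇒ifWord {n} (node (inj₂ k) ts) ((dc-eq , _) , _) with ∷-injective dc-eq
  ... | refl , dcs-eq
    with unembedVec ts (subst (All (_≡ inj₁ m)) (trans (sym (dcVec-corollas {m} n)) dcs-eq) (All.replicate⁺ n refl))
  ...   | us , eq = Vec.toList us , length-toList us , trans (ifWord-toList us) (cong (node (inj₂ n)) eq)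

  if∘bt≡ifWord∘word : (t : MTree m) → if (bt t) ≡ ifWord (word t)
  if∘bt≡ifWord∘word t = cong ifWord (inorder-bt t)

  if∘bt-InEasterlyWind : (t : MTree m) → InEasterlyWind m (degree t) (if (bt t))
  if∘bt-InEasterlyWind t =
    subst₂ (InEasterlyWind m) (length-word t) (sym (if∘bt≡ifWord∘word t))
      (Lukasiewicz⇒f↑⪯ (word t) (Lukasiewicz-word t) , Lukasiewicz⇒⪯f↓ (word t) (Lukasiewicz-word t))

  if∘bt-injective : (t₁ t₂ : MTree m) → if (bt t₁) ≡ if (bt t₂) → t₁ ≡ t₂
  if∘bt-injective t₁ t₂ eq = word-injective t₁ t₂ (ifWord-injective (word t₁) (word t₂) (begin
    ifWord (word t₁) ≡⟨ if∘bt≡ifWord∘word t₁ ⟨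
    if (bt t₁)       ≡⟨ eq ⟩
    if (bt t₂)       ≡⟨ if∘bt≡ifWord∘word t₂ ⟩
    ifWord (word t₂) ∎))
    where open ≡-Reasoning

  InEasterlyWind⇒if∘bt : ∀ {n} F → InEasterlyWind m n F → Σ (MTree m) λ t → degree t ≡ n × if (bt t) ≡ F
  InEasterlyWind⇒if∘bt F inF with InEasterlyWind⇒ifWord F inF
  ... | L , refl , refl with word-surjective L (f↑⪯⇒Lukasiewicz L (proj₁ inF))
  ...   | t , refl = t , sym (length-word t) , if∘bt≡ifWord∘word t

theorem4p2p4 : (m n : ℕ) →
    ((t : MTree m) → degree t ≡ n → InEasterlyWind m n (if (bt t)))
    × ((t₁ t₂ : MTree m) → degree t₁ ≡ n → degree t₂ ≡ n →
         if (bt t₁) ≡ if (bt t₂) → t₁ ≡ t₂)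
    × ((F : Term NN) → InEasterlyWind m n F →
         Σ (MTree m) (λ t → (degree t ≡ n) × (if (bt t) ≡ F)))
theorem4p2p4 m n =
  (λ t deg → subst (λ k → InEasterlyWind m k (if (bt t))) deg (if∘bt-InEasterlyWind t)) ,
  (λ t₁ t₂ _ _ → if∘bt-injective t₁ t₂) ,
  InEasterlyWind⇒if∘bt
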